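{- For every bicom $B$ and list $vs$ of variables, $\mathrm{biL}(\mathrm{chk}(B,vs))\cong\mathrm{chk}(\mathrm{biL}(B),vs)$ and $\mathrm{biR}(\mathrm{chk}(B,vs))=\mathrm{chk}(\mathrm{biR}(B),vs)$.
   Context: Commands: $c::=\mathsf{skip}\mid x:=e\mid\mathsf{hav}\ x\mid\mathsf{assert}\ p\mid c;c\mid\mathsf{if}\ e\ \mathsf{then}\ c\ \mathsf{else}\ c\mid\mathsf{while}\ e\ \mathsf{vnt}\ e_1\ \mathsf{do}\ c$ (expressions arbitrary functions on stores, $p$ a set of stores, $e_1$ an integer variant). Bicoms: $B::=\langle c|c'\rangle\mid\mathsf{assert}\ \mathcal P\mid\mathsf{havf}\ x\ \mathcal P\mid B;B\mid\mathsf{if}\ e|e'\ B_1B_2B_3B_4\mid\mathsf{while}\ e|e'\ \mathsf{algn}\ \mathcal L|\mathcal R\ \mathsf{vnt}\ E\ \mathsf{do}\ B$ ($\mathcal P,\mathcal L,\mathcal R$ relations on stores, $E:\mathsf{Store}^2\to\mathbb Z$). $\exists|x.\mathcal P=\{(s,s'):(s,s'[x\mapsto v])\in\mathcal P$ for some value $v$ of the type of $x\}$. Left projection $\mathrm{L}$: $\langle c|c'\rangle\mapsto c$; $\mathsf{assert}\ \mathcal P$, $\mathsf{havf}\ x\ \mathcal P\mapsto\mathsf{skip}$; homomorphic on sequence; $\mathsf{if}\ e|e'\ B_1..B_4\mapsto\mathsf{if}\ e\ \mathsf{then}\ \mathrm{L}(B_1)\ \mathsf{else}\ \mathrm{L}(B_3)$;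 bi-while $\mapsto\mathsf{while}\ e\ \mathsf{do}\ \mathrm{L}(B)$. $\mathrm{biL}(B)=\langle\mathrm{L}(B)|\mathsf{skip}\rangle$. $\mathrm{biR}$: $\langle c|c'\rangle\mapsto\langle\mathsf{skip}|c'\rangle$; $\mathsf{assert}\ \mathcal P$, $\mathsf{havf}\ x\ \mathcal P$ unchanged; homomorphic on sequence; $\mathsf{if}\ e|e'\ B_1..B_4\mapsto\mathsf{if}\ \mathrm{tt}|e'\ \mathrm{biR}(B_1)..\mathrm{biR}(B_4)$; $\mathsf{while}\ e|e'\ \mathsf{algn}\ \mathcal L|\mathcal R\ \mathsf{vnt}\ E\ \mathsf{do}\ B\mapsto\mathsf{while}\ \mathrm{ff}|e'\ \mathsf{algn}\ \mathrm{ff}|\mathcal R\ \mathsf{vnt}\ E\ \mathsf{do}\ \mathrm{biR}(B)$ (keeping $E$; $\mathrm{tt},\mathrm{ff}$ are constant expressions/relations). Kat equivalence $\simeq$: least congruence on commands (w.r.t. sequence, if, while; variants unchanged) with $\mathsf{skip};c\simeq c$, $c;\mathsf{skip}\simeq c$, $(\mathsf{if}\ \mathrm{tt}\ \mathsf{then}\ c\ \mathsf{else}\ d)\simeq c$, $(\mathsf{while}\ \mathrm{ff}\ \mathsf{vnt}\ e_1\ \mathsf{do}\ c)\simeq\mathsf{skip}$. $\cong$: least equivalence relation on bicoms containing $\langle\mathsf{skip}|c';d'\rangle\cong\langle\mathsf{skip}|c'\rangle;\langle\mathsf{skip}|d'\rangle$, $\langle c;d|\mathsf{skip}\rangle\cong\langle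 c|\mathsf{skip}\rangle;\langle d|\mathsf{skip}\rangle$, $\langle c|c'\rangle\cong\langle c|\mathsf{skip}\rangle;\langle\mathsf{skip}|c'\rangle$, and $\langle c|c'\rangle\cong\langle d|d'\rangle$ whenever $c\simeq d$ and $c'\simeq d'$. $\mathrm{modVars}(c)$ lists variables assigned or havoc'd in $c$; $\mathrm{modVarsR}(B)$ lists the variables $x$ of $\mathsf{havf}\ x\ \mathcal P$ in $B$ and $\mathrm{modVars}(c')$ for each $\langle c|c'\rangle$ in $B$. $\mathrm{uchk}(c,vs)$: identity on $\mathsf{skip}$, assignment, havoc, assert; homomorphic on sequence and if (same $vs$); $\mathsf{while}\ e\ \mathsf{vnt}\ e_1\ \mathsf{do}\ c_1\mapsto\mathsf{while}\ e\ \mathsf{vnt}\ e_1\ \mathsf{do}\ (x:=e_1;\mathrm{uchk}(c_1,vs);\mathsf{assert}\ \{s:0\le e_1(s)<s(x)\})$, with $x$ an integer variable not in $vs$ nor $\mathrm{modVars}(\mathrm{uchk}(c_1,vs))$ chosen by a fixed choice function. $\mathrm{chk}(B,vs)$: $\langle c|c'\rangle\mapsto\langle c|\mathrm{uchk}(c',vs)\rangle$; $\mathsf{assert}\ \mathcal P$ unchanged; $\mathsf{havf}\ x\ \mathcal P\mapsto\mathsf{assert}(\exists|x.\mathcal P);\mathsf{havf}\ x\ \mathcal P$; homomorphic on sequence and bi-if (same $vs$); $\mathsf{while}\ e|e'\ \mathsf{algn}\ \mathcal P|\mathcal P'\ \mathsf{vnt}\ E\ \mathsf{do}\ B_1\mapsto\mathsf{while}\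 e|e'\ \mathsf{algn}\ \mathcal P|\mathcal P'\ \mathsf{vnt}\ E\ \mathsf{do}\ B_2$ where $B_2=\mathsf{havf}\ x_1\ \{(s,s'):s'(x_1)=E(s,s')\};\ \mathsf{havf}\ x_2\ \{(s,s'):s'(x_2)=\mathrm{tt}\iff(e'(s')=\mathrm{tt}\wedge(s,s')\in\mathcal P')\};\ \mathrm{chk}(B_1,vs);\ \mathsf{assert}\ \{(s,s'):s'(x_2)=\mathrm{tt}\Rightarrow0\le E(s,s')<s'(x_1)\}$, with $x_1$ (integer) and $x_2$ (boolean) distinct, not in $vs$ nor $\mathrm{modVarsR}(\mathrm{chk}(B_1,vs))$, chosen by a fixed choice function. -}

module Defs where

open import Data.Nat using (ℕ)
import Data.Nat as ℕ
open import Data.Integer using (ℤ; +_; _≤_; _<_)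
open import Data.Bool using (Bool; true; false; if_then_else_)
open import Data.List using (List; []; _∷_; _++_)
open import Data.Product using (Σ; _×_)
open import Data.Empty using (⊥)
open import Function.Bundles using (_⇔_)
open import Relation.Binary.PropositionalEquality using (_≡_; refl; cong)
open import Relation.Nullary using (Dec; yes; no; ¬_)
open import Data.List.Membership.Propositional using (_∉_)

data Ty : Set where
  int  : Ty
  bool : Ty

Val : Ty → Set
Val int  = ℤ
Val bool = Bool

data Var : Set where
  var : Ty → ℕ → Var

tyOf : Var → Ty
tyOf (var t _) = t

Store : Set
Store = (x : Var) → Val (tyOf x)

_≟Ty_ : (a b : Ty) → Dec (a ≡ b)
int  ≟Ty int  = yes refl
int  ≟Ty bool = no (λ ())
bool ≟Ty int  = no (λ ())
bool ≟Ty bool = yes refl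

_≟V_ : (x y : Var) → Dec (x ≡ y)
var t n ≟V var u m with t ≟Ty u | n ℕ.≟ m
... | yes refl | yes refl = yes refl
... | no t≢u   | _        = no (λ { refl → t≢u refl })
... | yes _    | no n≢m   = no (λ { refl → n≢m refl })

upd : Store → (x : Var) → Val (tyOf x) → Store
upd s x v y with x ≟V y
... | yes refl = v
... | no _     = s y

Exp : Set
Exp = Store → Bool

Pred : Set₁
Pred = Store → Set

Rel : Set₁
Rel = Store → Store → Set

infixr 5 _⨾_
infix 6 _:=_

data Cmd : Set₁ where
  skip   : Cmd
  _:=_   : (x : Var) → (Store → Val (tyOf x)) → Cmd
  hav    : Var → Cmd
  assert : Pred → Cmd
  _⨾_    : Cmd → Cmd → Cmd
  If     : Exp → Cmd → Cmd → Cmd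
  While  : Exp → (Store → ℤ) → Cmd → Cmd   -- while e vnt e₁ do c

infixr 5 _⨟_

data Bicom : Set₁ where
  ⟨_∣_⟩  : Cmd → Cmd → Bicom
  bassert : Rel → Bicom
  havf    : Var → Rel → Bicom
  _⨟_     : Bicom → Bicom → Bicom
  bIf     : Exp → Exp → Bicom → Bicom → Bicom → Bicom → Bicom
  -- while e|e' algn 𝓛|𝓡 vnt E do B
  bWhile  : Exp → Exp → Rel → Rel → (Store → Store → ℤ) → Bicom → Bicom

ttE : Exp
ttE _ = true

ffE : Exp
ffE _ = false

ffR : Rel
ffR _ _ = ⊥

∃∣ : Var → Rel → Rel
∃∣ x P s s' = Σ (Val (tyOf x)) (λ v → P s (upd s' x v))

-- variant used for the left projection of a bi-while (the context
-- leaves it unspecified)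
defaultVnt : Store → ℤ
defaultVnt _ = + 0

Lp : Bicom → Cmd
Lp ⟨ c ∣ c' ⟩            = c
Lp (bassert P)           = skip
Lp (havf x P)            = skip
Lp (B ⨟ B')              = Lp B ⨾ Lp B'
Lp (bIf e e' B₁ B₂ B₃ B₄) = If e (Lp B₁) (Lp B₃)
Lp (bWhile e e' 𝓛 𝓡 E B) = While e defaultVnt (Lp B)

biL : Bicom → Bicom
biL B = ⟨ Lp B ∣ skip ⟩

biR : Bicom → Bicom
biR ⟨ c ∣ c' ⟩            = ⟨ skip ∣ c' ⟩
biR (bassert P)           = bassert P
biR (havf x P)            = havf x P
biR (B ⨟ B')              = biR B ⨟ biR B'
biR (bIf e e' B₁ B₂ B₃ B₄) = bIf ttE e' (biR B₁) (biR B₂) (biR B₃) (biR B₄)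
biR (bWhile e e' 𝓛 𝓡 E B) = bWhile ffE e' ffR 𝓡 E (biR B)

infix 4 _≃_ _≅_

data _≃_ : Cmd → Cmd → Set₁ where
  ≃-refl  : ∀ {c} → c ≃ c
  ≃-sym   : ∀ {c d} → c ≃ d → d ≃ c
  ≃-trans : ∀ {c d f} → c ≃ d → d ≃ f → c ≃ f
  ≃-seq   : ∀ {c c' d d'} → c ≃ c' → d ≃ d' → (c ⨾ d) ≃ (c' ⨾ d')
  ≃-if    : ∀ {e c c' d d'} → c ≃ c' → d ≃ d' → If e c d ≃ If e c' d'
  ≃-while : ∀ {e v c c'} → c ≃ c' → While e v c ≃ While e v c'
  skip-seq : ∀ {c} → (skip ⨾ c) ≃ c
  seq-skip : ∀ {c} → (c ⨾ skip) ≃ c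
  if-tt    : ∀ {c d} → If ttE c d ≃ c
  while-ff : ∀ {v c} → While ffE v c ≃ skip

data _≅_ : Bicom → Bicom → Set₁ where
  ≅-refl  : ∀ {B} → B ≅ B
  ≅-sym   : ∀ {B C} → B ≅ C → C ≅ B
  ≅-trans : ∀ {B C D} → B ≅ C → C ≅ D → B ≅ D
  splitR  : ∀ {c' d'} → ⟨ skip ∣ c' ⨾ d' ⟩ ≅ (⟨ skip ∣ c' ⟩ ⨟ ⟨ skip ∣ d' ⟩)
  splitL  : ∀ {c d} → ⟨ c ⨾ d ∣ skip ⟩ ≅ (⟨ c ∣ skip ⟩ ⨟ ⟨ d ∣ skip ⟩)
  splitLR : ∀ {c c'} → ⟨ c ∣ c' ⟩ ≅ (⟨ c ∣ skip ⟩ ⨟ ⟨ skip ∣ c' ⟩)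
  kat     : ∀ {c c' d d'} → c ≃ d → c' ≃ d' → ⟨ c ∣ c' ⟩ ≅ ⟨ d ∣ d' ⟩

modVars : Cmd → List Var
modVars skip          = []
modVars (x := e)      = x ∷ []
modVars (hav x)       = x ∷ []
modVars (assert p)    = []
modVars (c ⨾ d)       = modVars c ++ modVars d
modVars (If e c d)    = modVars c ++ modVars d
modVars (While e v c) = modVars c

modVarsR : Bicom → List Var
modVarsR ⟨ c ∣ c' ⟩             = modVars c'
modVarsR (bassert P)            = []
modVarsR (havf x P)             = x ∷ []
modVarsR (B ⨟ B')               = modVarsR B ++ modVarsR B'
modVarsR (bIf e e' B₁ B₂ B₃ B₄) = modVarsR B₁ ++ modVarsR B₂ ++ modVarsR B₃ ++ modVarsR B₄
modVarsR (bWhile e e' 𝓛 𝓡 E B)  = modVarsR B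

-- Adding termination checks.  A choice function `fr` gives, for a type
-- and a list of variables to avoid, the name of a fresh variable.

Chooser : Set
Chooser = Ty → List Var → ℕ

uchk : Chooser → Cmd → List Var → Cmd
uchk fr skip          vs = skip
uchk fr (x := e)      vs = x := e
uchk fr (hav x)       vs = hav x
uchk fr (assert p)    vs = assert p
uchk fr (c ⨾ d)       vs = uchk fr c vs ⨾ uchk fr d vs
uchk fr (If e c d)    vs = If e (uchk fr c vs) (uchk fr d vs)
uchk fr (While e v c) vs =
  While e v ((x := v ⨾ c₁) ⨾ assert (λ s → (+ 0 ≤ v s) × (v s < s x)))
  where
  c₁ = uchk fr c vs
  x  = var int (fr int (vs ++ modVars c₁))

chk : Chooser → Bicom → List Var → Bicom
chk fr ⟨ c ∣ c' ⟩ vs = ⟨ c ∣ uchk fr c' vs ⟩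
chk fr (bassert P) vs = bassert P
chk fr (havf x P) vs = bassert (∃∣ x P) ⨟ havf x P
chk fr (B ⨟ B') vs = chk fr B vs ⨟ chk fr B' vs
chk fr (bIf e e' B₁ B₂ B₃ B₄) vs =
  bIf e e' (chk fr B₁ vs) (chk fr B₂ vs) (chk fr B₃ vs) (chk fr B₄ vs)
chk fr (bWhile e e' 𝓟 𝓟' E B₁) vs =
  bWhile e e' 𝓟 𝓟' E
    (((havf x₁ (λ s s' → s' x₁ ≡ E s s')
      ⨟ havf x₂ (λ s s' → (s' x₂ ≡ true) ⇔ ((e' s' ≡ true) × 𝓟' s s')))
      ⨟ B₁')
      ⨟ bassert (λ s s' → s' x₂ ≡ true → (+ 0 ≤ E s s') × (E s s' < s' x₁)))
  where
  B₁' = chk fr B₁ vs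
  avoid = vs ++ modVarsR B₁'
  x₁ = var int (fr int avoid)
  -- x₂ is chosen avoiding x₁ as well, so x₁ and x₂ are distinct
  x₂ = var bool (fr bool (x₁ ∷ avoid))

FreshChooser : Chooser → Set
FreshChooser fr = ∀ t (xs : List Var) → var t (fr t xs) ∉ xs

-- On the left, chk only inserts asserts and havocs, which project to skip, so L(chk B) is L(B)
-- padded with skips and the Kat unit laws remove them.  On the right, chk and biR commute
-- clause by clause; the one subtlety is that the fresh names of a checked loop body are chosen
-- to avoid modVarsR of the checked inner body, and biR does not change modVarsR.
module Submission where

open import Defs
open import Data.List using (List; _∷_; _++_)
open import Data.Product using (_×_; _,_)
open import Data.Bool using (true)
open import Data.Integer using (ℤ; +_; _≤_; _<_)
open import Function.Bundles using (_⇔_)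
open import Relation.Binary.Bundles using (Setoid)
open import Relation.Binary.PropositionalEquality using (_≡_; refl; cong; cong₂; trans; sym)

≃-setoid : Setoid _ _
≃-setoid = record
  { Carrier = Cmd
  ; _≈_ = _≃_
  ; isEquivalence = record { refl = ≃-refl ; sym = ≃-sym ; trans = ≃-trans }
  }

Lp-chk : (fr : Chooser) (B : Bicom) (vs : List Var) → Lp (chk fr B vs) ≃ Lp B
Lp-chk fr ⟨ c ∣ c' ⟩ vs = ≃-refl
Lp-chk fr (bassert P) vs = ≃-refl
Lp-chk fr (havf x P) vs = skip-seq
Lp-chk fr (B ⨟ B') vs = ≃-seq (Lp-chk fr B vs) (Lp-chk fr B' vs)
Lp-chk fr (bIf e e' B₁ B₂ B₃ B₄) vs = ≃-if (Lp-chk fr B₁ vs) (Lp-chk fr B₃ vs)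
Lp-chk fr (bWhile e e' 𝓛 𝓡 E B) vs = ≃-while body
  where
  open import Relation.Binary.Reasoning.Setoid ≃-setoid
  body : ((skip ⨾ skip) ⨾ Lp (chk fr B vs)) ⨾ skip ≃ Lp B
  body = begin
    ((skip ⨾ skip) ⨾ Lp (chk fr B vs)) ⨾ skip ≈⟨ seq-skip ⟩
    (skip ⨾ skip) ⨾ Lp (chk fr B vs)          ≈⟨ ≃-seq skip-seq ≃-refl ⟩
    skip ⨾ Lp (chk fr B vs)                   ≈⟨ skip-seq ⟩
    Lp (chk fr B vs)                          ≈⟨ Lp-chk fr B vs ⟩
    Lp B                                      ∎

modVarsR-biR : (B : Bicom) → modVarsR (biR B) ≡ modVarsR B
modVarsR-biR ⟨ c ∣ c' ⟩ = refl
modVarsR-biR (bassert P) = refl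
modVarsR-biR (havf x P) = refl
modVarsR-biR (B ⨟ B') = cong₂ _++_ (modVarsR-biR B) (modVarsR-biR B')
modVarsR-biR (bIf e e' B₁ B₂ B₃ B₄) =
  cong₂ _++_ (modVarsR-biR B₁)
    (cong₂ _++_ (modVarsR-biR B₂) (cong₂ _++_ (modVarsR-biR B₃) (modVarsR-biR B₄)))
modVarsR-biR (bWhile e e' 𝓛 𝓡 E B) = modVarsR-biR B

-- The body that chk builds for a bi-while, with the checked inner body `B'` and the list `ms`
-- of variables it modifies as separate arguments; chk takes `ms = modVarsR B'`, so the while
-- clause of chk unfolds to it definitionally.
checkedLoopBody : Chooser → List Var → Exp → Rel → (Store → Store → ℤ) →
                  (ms : List Var) → (B' : Bicom) → Bicom
checkedLoopBody fr vs e' 𝓡 E ms B' =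
  ((havf x₁ (λ s s' → s' x₁ ≡ E s s')
    ⨟ havf x₂ (λ s s' → (s' x₂ ≡ true) ⇔ ((e' s' ≡ true) × 𝓡 s s')))
    ⨟ B')
    ⨟ bassert (λ s s' → s' x₂ ≡ true → (+ 0 ≤ E s s') × (E s s' < s' x₁))
  where
  x₁ = var int (fr int (vs ++ ms))
  x₂ = var bool (fr bool (x₁ ∷ vs ++ ms))

biR-chk : (fr : Chooser) (B : Bicom) (vs : List Var) → biR (chk fr B vs) ≡ chk fr (biR B) vs
biR-chk fr ⟨ c ∣ c' ⟩ vs = refl
biR-chk fr (bassert P) vs = refl
biR-chk fr (havf x P) vs = refl
biR-chk fr (B ⨟ B') vs = cong₂ _⨟_ (biR-chk fr B vs) (biR-chk fr B' vs)
biR-chk fr (bIf e e' B₁ B₂ B₃ B₄) vs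
  rewrite biR-chk fr B₁ vs | biR-chk fr B₂ vs | biR-chk fr B₃ vs | biR-chk fr B₄ vs = refl
biR-chk fr (bWhile e e' 𝓛 𝓡 E B) vs =
  cong (bWhile ffE e' ffR 𝓡 E)
    (cong₂ (checkedLoopBody fr vs e' 𝓡 E) same-modVarsR (biR-chk fr B vs))
  where
  same-modVarsR : modVarsR (chk fr B vs) ≡ modVarsR (chk fr (biR B) vs)
  same-modVarsR = trans (sym (modVarsR-biR (chk fr B vs))) (cong modVarsR (biR-chk fr B vs))

lemma5p1 : (fr : Chooser) → FreshChooser fr → (B : Bicom) → (vs : List Var) →
    (biL (chk fr B vs) ≅ chk fr (biL B) vs) × (biR (chk fr B vs) ≡ chk fr (biR B) vs)
lemma5p1 fr _ B vs = kat (Lp-chk fr B vs) ≃-refl , biR-chk fr B vs
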